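{- Let $n$ be a positive integer with $n\equiv \pm 2\pmod{12}$. Then it is possible to place $n-1$ queens on $\mathbb{Z}_n^2$ with no two in conflict.
   Context: Queens on the toroidal board $\mathbb{Z}_n^2$ occupy distinct fields; two queens at $(x,y)$ and $(x',y')$ are in conflict iff $x=x'$, or $y=y'$, or $x+y=x'+y'$, or $x-y=x'-y'$ in $\mathbb{Z}_n$. -}

module Defs where

open import Data.Nat using (ℕ; zero; suc; _+_; _∸_; _%_; NonZero)
open import Data.Fin using (Fin; toℕ)
open import Data.Product using (_×_; _,_; proj₁; proj₂)
open import Data.Sum using (_⊎_)
open import Relation.Binary.PropositionalEquality using (_≡_)
open import Relation.Nullary using (¬_)

Field : ℕ → Set
Field n = Fin n × Fin n

Conflict : (n : ℕ) → .{{_ : NonZero n}} → Field n → Field n → Set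
Conflict n (x , y) (x' , y') =
  x ≡ x'
  ⊎ (y ≡ y'
  ⊎ ((toℕ x + toℕ y) % n ≡ (toℕ x' + toℕ y') % n
  ⊎ (toℕ x + (n ∸ toℕ y)) % n ≡ (toℕ x' + (n ∸ toℕ y')) % n))

NonAttacking : (n k : ℕ) → .{{_ : NonZero n}} → (Fin k → Field n) → Set
NonAttacking n k q =
  (i j : Fin k) → ¬ i ≡ j → (¬ q i ≡ q j) × ¬ Conflict n (q i) (q j)

-- Write n = 2k. The queens sit at (x, 3x) for 0 ≤ x < k and at (x, 3x + 3) for k ≤ x ≤ 2k − 2.
-- For queens in columns x < x + d every conflict condition becomes n ∣ c for an explicit c.
-- Within one half c is 3d, 4d or 2d with 0 < d < k, impossible since 3 ∤ n and k is odd.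
-- Across the halves c is 3(d + 1) with d + 1 < n, again impossible since 3 ∤ n, or, for the
-- two diagonals, c is odd while n is even.
module Submission where

open import Defs
open import Data.Nat using (ℕ; suc; _+_; _*_; _∸_; _%_; _/_; _≤_; _<_; _<?_; s≤s; z≤n; NonZero)
open import Data.Nat.Properties
open import Data.Nat.DivMod using (m≡m%n+[m/n]*n; [m+n]%n≡m%n; %-distribˡ-+; m%n%n≡m%n; _mod_)
open import Data.Nat.Divisibility
open import Data.Nat.Coprimality using (Coprime; coprime-divisor)
open import Data.Nat.Primality using (Prime; prime?; prime[2]; prime⇒irreducible)
open import Data.Nat.Tactic.RingSolver using (solve-∀)
open import Data.Fin using (Fin; toℕ; inject₁)
open import Data.Fin.Properties using (toℕ-fromℕ<; toℕ-injective; inject₁-injective; toℕ-inject₁; toℕ<n)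
open import Data.Product using (Σ; _,_; _×_; proj₁)
open import Data.Sum using (_⊎_; inj₁; inj₂)
open import Function using (_∘_)
open import Relation.Nullary using (¬_; yes; no; contradiction)
open import Relation.Nullary.Decidable using (from-yes; from-no)
open import Relation.Binary using (tri<; tri≈; tri>)
open import Relation.Binary.PropositionalEquality

prime[3] : Prime 3
prime[3] = from-yes (prime? 3)

∤⇒coprime : ∀ {p n} → Prime p → p ∤ n → Coprime n p
∤⇒coprime p p∤n (d∣n , d∣p) with prime⇒irreducible p d∣p
... | inj₁ d≡1    = d≡1
... | inj₂ refl   = contradiction d∣n p∤n

m%o≡[m+n]%o⇒o∣n : ∀ m n o .{{_ : NonZero o}} → m % o ≡ (m + n) % o → o ∣ n
m%o≡[m+n]%o⇒o∣n m n o eq = ∣m+n∣m⇒∣n (divides ((m + n) / o) m/o*o+n≡) (n∣m*n (m / o))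
  where
  open ≡-Reasoning
  m/o*o+n≡ : m / o * o + n ≡ (m + n) / o * o
  m/o*o+n≡ = +-cancelˡ-≡ (m % o) _ _ (begin
    m % o + (m / o * o + n)         ≡⟨ +-assoc (m % o) _ n ⟨
    m % o + m / o * o + n           ≡⟨ cong (_+ n) (m≡m%n+[m/n]*n m o) ⟨
    m + n                           ≡⟨ m≡m%n+[m/n]*n (m + n) o ⟩
    (m + n) % o + (m + n) / o * o   ≡⟨ cong (_+ (m + n) / o * o) eq ⟨
    m % o + (m + n) / o * o         ∎)

[m+n%o]%o≡[m+n]%o : ∀ m n o .{{_ : NonZero o}} → (m + n % o) % o ≡ (m + n) % o
[m+n%o]%o≡[m+n]%o m n o = begin
  (m + n % o) % o             ≡⟨ %-distribˡ-+ m (n % o) o ⟩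
  (m % o + n % o % o) % o     ≡⟨ cong (λ r → (m % o + r) % o) (m%n%n≡m%n n o) ⟩
  (m % o + n % o) % o         ≡⟨ %-distribˡ-+ m n o ⟨
  (m + n) % o                 ∎
  where open ≡-Reasoning

-- In ℤ_o: a − b ≡ a' − b' implies a + b' ≡ a' + b, with o ∸ b standing for −b.
antidiagonal⇒cross-sum : ∀ a a' b b' o .{{_ : NonZero o}} → b ≤ o → b' ≤ o →
  (a + (o ∸ b)) % o ≡ (a' + (o ∸ b')) % o → (a + b') % o ≡ (a' + b) % o
antidiagonal⇒cross-sum a a' b b' o b≤o b'≤o eq = begin
  (a + b') % o                               ≡⟨ [m+n]%n≡m%n (a + b') o ⟨
  (a + b' + o) % o                           ≡⟨ cong (_% o) (add-back a b b' b≤o) ⟨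
  (a + (o ∸ b) + (b + b')) % o               ≡⟨ %-distribˡ-+ (a + (o ∸ b)) (b + b') o ⟩
  ((a + (o ∸ b)) % o + (b + b') % o) % o     ≡⟨ cong (λ r → (r + (b + b') % o) % o) eq ⟩
  ((a' + (o ∸ b')) % o + (b + b') % o) % o   ≡⟨ %-distribˡ-+ (a' + (o ∸ b')) (b + b') o ⟨
  (a' + (o ∸ b') + (b + b')) % o             ≡⟨ cong (λ r → (a' + (o ∸ b') + r) % o) (+-comm b b') ⟩
  (a' + (o ∸ b') + (b' + b)) % o             ≡⟨ cong (_% o) (add-back a' b' b b'≤o) ⟩
  (a' + b + o) % o                           ≡⟨ [m+n]%n≡m%n (a' + b) o ⟩
  (a' + b) % o                               ∎
  where
  open ≡-Reasoning
  ring : ∀ a u b c → a + u + (b + c) ≡ a + c + (u + b)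
  ring = solve-∀
  add-back : ∀ a b c → b ≤ o → a + (o ∸ b) + (b + c) ≡ a + c + o
  add-back a b c b≤o = begin
    a + (o ∸ b) + (b + c)     ≡⟨ ring a (o ∸ b) b c ⟩
    a + c + (o ∸ b + b)       ≡⟨ cong (a + c +_) (m∸n+n≡m b≤o) ⟩
    a + c + o                 ∎

module _ {R : ℕ → ℕ → Set} {b : ℕ} (gap : ∀ x d .{{_ : NonZero d}} → x + d < b → ¬ R x (x + d)) where

  <⇒¬R : ∀ {x y} → x < y → y < b → ¬ R x y
  <⇒¬R {x} x<y with m≤n⇒∃[o]m+o≡n x<y
  ... | o , refl = subst (λ y → y < b → ¬ R x y) (+-suc x o) (gap x (suc o))

  gaps-excluded⇒≡ : (∀ {x y} → R x y → R y x) → ∀ {x y} → x < b → y < b → R x y → x ≡ y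
  gaps-excluded⇒≡ R-sym {x} {y} x<b y<b r with <-cmp x y
  ... | tri< x<y _ _ = contradiction r (<⇒¬R x<y y<b)
  ... | tri≈ _ x≡y _ = x≡y
  ... | tri> _ _ y<x = contradiction (R-sym r) (<⇒¬R y<x x<b)

module Placement (m k : ℕ) (n≡2k : suc m ≡ 2 * k) (2∤k : 2 ∤ k) (3∤n : 3 ∤ suc m) where

  n : ℕ
  n = suc m

  row : ℕ → ℕ
  row x with x <? k
  ... | yes _ = 3 * x
  ... | no  _ = 3 * suc x

  k≤n : k ≤ n
  k≤n = subst (k ≤_) (sym n≡2k) (m≤n*m k 2)

  row-step : ∀ x d → x + d < m →
    (d < k × row (x + d) ≡ row x + 3 * d) ⊎ (suc d < n × row (x + d) ≡ row x + 3 * suc d)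
  row-step x d x+d<m with x + d <? k | x <? k
  ... | yes x+d<k | yes _   = inj₁ (≤-<-trans (m≤n+m d x) x+d<k , *-distribˡ-+ 3 x d)
  ... | yes x+d<k | no  x≮k = contradiction (≤-<-trans (m≤m+n x d) x+d<k) x≮k
  ... | no  _     | yes _   = inj₂ (s≤s (≤-<-trans (m≤n+m d x) x+d<m) ,
                                    trans (cong (3 *_) (sym (+-suc x d))) (*-distribˡ-+ 3 x (suc d)))
  ... | no  _     | no  x≮k = inj₁ (d<k , *-distribˡ-+ 3 (suc x) d)
    where
    d<k : d < k
    d<k = +-cancelˡ-< k d k (begin-strict
      k + d    ≤⟨ +-monoˡ-≤ d (≮⇒≥ x≮k) ⟩
      x + d    <⟨ m<n⇒m<1+n x+d<m ⟩
      n        ≡⟨ trans n≡2k (cong (k +_) (+-identityʳ k)) ⟩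
      k + k    ∎)
      where open ≤-Reasoning

  shift⇒∣ : ∀ a {b} c → b ≡ a + c → a % n ≡ b % n → n ∣ c
  shift⇒∣ a c refl = m%o≡[m+n]%o⇒o∣n a c n

  n∤3* : ∀ e .{{_ : NonZero e}} → e < n → n ∤ 3 * e
  n∤3* e e<n n∣3e = >⇒∤ e<n (coprime-divisor (∤⇒coprime prime[3] 3∤n) n∣3e)

  n∣2*⇒k∣ : ∀ {e} → n ∣ 2 * e → k ∣ e
  n∣2*⇒k∣ {e} n∣2e = *-cancelˡ-∣ 2 (subst (_∣ 2 * e) n≡2k n∣2e)

  n∤odd : ∀ q → n ∤ 2 * q + 1
  n∤odd q n∣odd = >⇒∤ (s≤s (s≤s z≤n)) (∣m+n∣m⇒∣n 2∣odd (m∣m*n q))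
    where
    2∣odd : 2 ∣ 2 * q + 1
    2∣odd = ∣-trans (divides k (trans n≡2k (*-comm 2 k))) n∣odd

  SameRow SameDiagonal SameAntidiagonal : ℕ → ℕ → Set
  SameRow x y          = row x % n ≡ row y % n
  SameDiagonal x y     = (x + row x) % n ≡ (y + row y) % n
  SameAntidiagonal x y = (x + row y) % n ≡ (y + row x) % n

  rows-apart : ∀ x d .{{_ : NonZero d}} → x + d < m → ¬ SameRow x (x + d)
  rows-apart x d x+d<m same with row-step x d x+d<m
  ... | inj₁ (d<k , step)    = n∤3* d (<-≤-trans d<k k≤n) (shift⇒∣ (row x) _ step same)
  ... | inj₂ (1+d<n , step)  = n∤3* (suc d) 1+d<n (shift⇒∣ (row x) _ step same)

  diagonals-apart : ∀ x d .{{_ : NonZero d}} → x + d < m → ¬ SameDiagonal x (x + d)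
  diagonals-apart x d x+d<m same with row-step x d x+d<m
  ... | inj₁ (d<k , step) = >⇒∤ d<k (coprime-divisor (∤⇒coprime prime[2] 2∤k) (n∣2*⇒k∣ n∣4d))
    where
    ring : ∀ x d r → x + d + (r + 3 * d) ≡ x + r + 2 * (2 * d)
    ring = solve-∀
    n∣4d : n ∣ 2 * (2 * d)
    n∣4d = shift⇒∣ (x + row x) _ (trans (cong (x + d +_) step) (ring x d (row x))) same
  ... | inj₂ (_ , step) = n∤odd (2 * d + 1) n∣4d+3
    where
    ring : ∀ x d r → x + d + (r + 3 * suc d) ≡ x + r + (2 * (2 * d + 1) + 1)
    ring = solve-∀
    n∣4d+3 : n ∣ 2 * (2 * d + 1) + 1
    n∣4d+3 = shift⇒∣ (x + row x) _ (trans (cong (x + d +_) step) (ring x d (row x))) same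

  antidiagonals-apart : ∀ x d .{{_ : NonZero d}} → x + d < m → ¬ SameAntidiagonal x (x + d)
  antidiagonals-apart x d x+d<m same with row-step x d x+d<m
  ... | inj₁ (d<k , step) = >⇒∤ d<k (n∣2*⇒k∣ n∣2d)
    where
    ring : ∀ x d r → x + (r + 3 * d) ≡ x + d + r + 2 * d
    ring = solve-∀
    n∣2d : n ∣ 2 * d
    n∣2d = shift⇒∣ (x + d + row x) _ (trans (cong (x +_) step) (ring x d (row x))) (sym same)
  ... | inj₂ (_ , step) = n∤odd (suc d) n∣2d+3
    where
    ring : ∀ x d r → x + (r + 3 * suc d) ≡ x + d + r + (2 * suc d + 1)
    ring = solve-∀
    n∣2d+3 : n ∣ 2 * suc d + 1
    n∣2d+3 = shift⇒∣ (x + d + row x) _ (trans (cong (x +_) step) (ring x d (row x))) (sym same)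

  place : Fin n → Field n
  place c = c , row (toℕ c) mod n

  [a+row]%n : ∀ a x → (a + toℕ (row x mod n)) % n ≡ (a + row x) % n
  [a+row]%n a x = trans (cong (λ r → (a + r) % n) (toℕ-fromℕ< _)) ([m+n%o]%o≡[m+n]%o a (row x) n)

  place-conflict : ∀ {c c'} → toℕ c < m → toℕ c' < m → Conflict n (place c) (place c') → c ≡ c'
  place-conflict c<m c'<m (inj₁ same-column) = same-column
  place-conflict c<m c'<m (inj₂ (inj₁ same-row)) =
    toℕ-injective (gaps-excluded⇒≡ {R = SameRow} rows-apart sym c<m c'<m
      (subst₂ _≡_ (toℕ-fromℕ< _) (toℕ-fromℕ< _) (cong toℕ same-row)))
  place-conflict {c} {c'} c<m c'<m (inj₂ (inj₂ (inj₁ same-diagonal))) =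
    toℕ-injective (gaps-excluded⇒≡ {R = SameDiagonal} diagonals-apart sym c<m c'<m
      (trans (sym ([a+row]%n (toℕ c) (toℕ c))) (trans same-diagonal ([a+row]%n (toℕ c') (toℕ c')))))
  place-conflict {c} {c'} c<m c'<m (inj₂ (inj₂ (inj₂ same-antidiagonal))) =
    toℕ-injective (gaps-excluded⇒≡ {R = SameAntidiagonal} antidiagonals-apart sym c<m c'<m
      (trans (sym ([a+row]%n (toℕ c) (toℕ c'))) (trans cross ([a+row]%n (toℕ c') (toℕ c)))))
    where
    cross : (toℕ c + toℕ (row (toℕ c') mod n)) % n ≡ (toℕ c' + toℕ (row (toℕ c) mod n)) % n
    cross = antidiagonal⇒cross-sum (toℕ c) (toℕ c') _ _ n (<⇒≤ (toℕ<n _)) (<⇒≤ (toℕ<n _))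
              same-antidiagonal

  queens : Σ (Fin m → Field n) (NonAttacking n m)
  queens = place ∘ inject₁ ,
           λ i j i≢j → i≢j ∘ injective i j ∘ inj₁ ∘ cong proj₁ , i≢j ∘ injective i j
    where
    column<m : ∀ i → toℕ (inject₁ i) < m
    column<m i = subst (_< m) (sym (toℕ-inject₁ i)) (toℕ<n i)
    injective : ∀ i j → Conflict n (place (inject₁ i)) (place (inject₁ j)) → i ≡ j
    injective i j = inject₁-injective ∘ place-conflict (column<m i) (column<m j)

queens-on-torus : ∀ m → 2 ∣ suc m → 4 ∤ suc m → 3 ∤ suc m →
  Σ (Fin m → Field (suc m)) (NonAttacking (suc m) m)
queens-on-torus m (divides k n≡k*2) 4∤n 3∤n = Placement.queens m k n≡2k 2∤k 3∤n
  where
  n≡2k : suc m ≡ 2 * k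
  n≡2k = trans n≡k*2 (*-comm k 2)
  2∤k : 2 ∤ k
  2∤k 2∣k = 4∤n (subst (4 ∣_) (sym n≡2k) (*-monoʳ-∣ 2 2∣k))

residue-divisibility : ∀ n {r} → n % 12 ≡ r → 2 ∣ r → 4 ∤ r → 3 ∤ r → 2 ∣ n × 4 ∤ n × 3 ∤ n
residue-divisibility n refl 2∣r 4∤r 3∤r =
  ∣n∣m%n⇒∣m (divides 6 refl) 2∣r ,
  (λ 4∣n → 4∤r (%-presˡ-∣ 4∣n (divides 3 refl))) ,
  (λ 3∣n → 3∤r (%-presˡ-∣ 3∣n (divides 4 refl)))

≡±2-mod-12⇒divisibility : ∀ n → n % 12 ≡ 2 ⊎ n % 12 ≡ 10 → 2 ∣ n × 4 ∤ n × 3 ∤ n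
≡±2-mod-12⇒divisibility n (inj₁ n%12≡2) =
  residue-divisibility n n%12≡2 (divides 1 refl) (from-no (4 ∣? 2)) (from-no (3 ∣? 2))
≡±2-mod-12⇒divisibility n (inj₂ n%12≡10) =
  residue-divisibility n n%12≡10 (divides 5 refl) (from-no (4 ∣? 10)) (from-no (3 ∣? 10))

lemma2 : (m : ℕ) → (suc m % 12 ≡ 2 ⊎ suc m % 12 ≡ 10) →
    Σ (Fin (suc m ∸ 1) → Field (suc m)) (λ q → NonAttacking (suc m) (suc m ∸ 1) q)
lemma2 m n≡±2 with ≡±2-mod-12⇒divisibility (suc m) n≡±2
... | 2∣n , 4∤n , 3∤n = queens-on-torus m 2∣n 4∤n 3∤n
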